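{- Let $\langle X,\tau,\le,\eta_1,\eta_2,C\rangle$ be an MNE-space. Then $F_C=\{U\in\mathcal{U}(X): C\subseteq U\}$ is a Boolean filter of the Heyting algebra $\mathcal{U}(X)$ which satisfies: for all $U,V\in\mathcal{U}(X)$, if $U\cap V=\emptyset$ and $U\cup V\in F_C$ then $\Box_{\eta_1}(U)\cup\Diamond_{\eta_2}(V)\in F_C$. Consequently $\langle\mathcal{U}(X),\Box_{\eta_1},\Diamond_{\eta_2}\rangle$ together with $F_C$ is a pair consisting of a modal Heyting algebra and a Boolean filter with this property.
   Context: An Esakia space is a compact ordered space $\langle X,\tau,\le\rangle$ such that if $x\not\le y$ there is a clopen up-set containing $x$ but not $y$, and ${\downarrow}U$ is clopen for every clopen $U$. $\mathcal{U}(X)$ (clopen up-sets) is a Heyting algebra with $\cap,\cup,\emptyset,X$ and $U\to V=\{x: {\uparrow}x\cap U\subseteq V\}$; $\mathcal{D}(X)$ denotes clopen down-sets. A filter $F$ of a Heyting algebra is Boolean if it contains every $x$ with $--x=\top$ where $-x=x\to\bot$. A modal Esakia space is $\langle X,\tau,\le,\eta_1,\eta_2\rangle$ with $\eta_1,\eta_2\colon X\to\mathcal{P}(\mathcal{P}(X))$ such that for all $x$, $U,V\in\mathcal{U}(X)$: $\eta_1(x)\subseteq\mathcal{U}(X)$, $\eta_2(x)\subseteq\mathcal{D}(X)$; $\Box_{\eta_1}(U)=\{x: U\in\eta_1(x)\}$ and $\Diamond_{\eta_2}(U)=\{x: X\setminus U\notin\eta_2(x)\}$ are clopen up-sets; if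 $U\in\eta_1(x)$ then ${\downarrow}U\cup(X\setminus V)\in\eta_2(x)$. An MNE-space is $\langle X,\tau,\le,\eta_1,\eta_2,C\rangle$ with $\langle X,\tau,\le,\eta_1,\eta_2\rangle$ a modal Esakia space and $C$ a closed subset of the set $\max(X)$ of maximal elements such that for all $U,V\in\mathcal{U}(X)$: if $C\subseteq U\cup V$ and $U\cap V=\emptyset$ then $C\subseteq\Box_{\eta_1}(U)\cup\Diamond_{\eta_2}(V)$. A modal Heyting algebra is a Heyting algebra with unary $\Box,\Diamond$ satisfying $\Box a\wedge\Diamond(-a\wedge b)=\bot$. -}

module Defs where

open import Level using (0ℓ)
open import Data.Product using (Σ; ∃; ∃₂; _×_; _,_)
open import Data.List using (List)
open import Data.List.Relation.Unary.All using (All)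
open import Data.List.Relation.Unary.Any using (Any)
open import Relation.Nullary using (¬_)
open import Relation.Binary using (Rel; IsPartialOrder)
open import Relation.Binary.PropositionalEquality using (_≡_)
open import Relation.Unary public
  using (Pred; ∅; _∩_; _∪_; ∁; _⊆_; _≐_)
  renaming (U to Full)

Subset : Set → Set₁
Subset X = Pred X 0ℓ

record IsTopology {X : Set} (τ : Pred (Subset X) 0ℓ) : Set₁ where
  field
    -- being open is a property of the subset (extensional)
    open-resp  : ∀ {A B : Subset X} → A ≐ B → τ A → τ B
    ∅-open     : τ ∅
    Full-open  : τ Full
    ∩-open     : ∀ {A B : Subset X} → τ A → τ B → τ (A ∩ B)
    ⋃-open     : (𝒜 : Pred (Subset X) 0ℓ) (B : Subset X) →
                 (∀ A → 𝒜 A → τ A) →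
                 (∀ x → B x → ∃ λ A → 𝒜 A × A x) →
                 (∀ x → (∃ λ A → 𝒜 A × A x) → B x) →
                 τ B

module _ {X : Set} (τ : Pred (Subset X) 0ℓ) where

  Compact : Set₁
  Compact = (𝒜 : Pred (Subset X) 0ℓ) → (∀ A → 𝒜 A → τ A) →
            (∀ x → ∃ λ A → 𝒜 A × A x) →
            ∃ λ (As : List (Subset X)) → All 𝒜 As × (∀ x → Any (λ A → A x) As)

  Closed : Subset X → Set
  Closed A = τ (∁ A)

  Clopen : Subset X → Set
  Clopen A = τ A × τ (∁ A)

module _ {X : Set} (_≤_ : Rel X 0ℓ) where

  IsUp : Subset X → Set
  IsUp A = ∀ {x y} → x ≤ y → A x → A y

  IsDown : Subset X → Set
  IsDown A = ∀ {x y} → y ≤ x → A x → A y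

  ↑_ : X → Subset X
  ↑ x = λ y → x ≤ y

  ↓_ : Subset X → Subset X
  ↓ A = λ y → ∃ λ a → A a × y ≤ a

  _⇒_ : Subset X → Subset X → Subset X
  (A ⇒ B) x = ∀ y → x ≤ y → A y → B y

  ─_ : Subset X → Subset X
  ─ A = A ⇒ ∅

  IsMax : X → Set
  IsMax x = ∀ y → x ≤ y → y ≡ x

  MaxSet : Subset X
  MaxSet = IsMax

  -- the order is closed in X × X (product topology)
  OrderClosed : Pred (Subset X) 0ℓ → Set₁
  OrderClosed τ = ∀ x y → ¬ (x ≤ y) →
    ∃₂ λ (A B : Subset X) → τ A × τ B × A x × B y ×
       (∀ a b → A a → B b → ¬ (a ≤ b))

module _ {X : Set} (τ : Pred (Subset X) 0ℓ) (_≤_ : Rel X 0ℓ) where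

  -- membership in 𝒰(X) (clopen up-sets) and 𝒟(X) (clopen down-sets)
  ClopenUp : Subset X → Set
  ClopenUp A = Clopen τ A × IsUp _≤_ A

  ClopenDown : Subset X → Set
  ClopenDown A = Clopen τ A × IsDown _≤_ A

  record IsEsakiaSpace : Set₁ where
    field
      topology     : IsTopology τ
      partialOrder : IsPartialOrder _≡_ _≤_
      compact      : Compact τ
      orderClosed  : OrderClosed _≤_ τ
      separation   : ∀ x y → ¬ (x ≤ y) → ∃ λ A → ClopenUp A × A x × ¬ A y
      ↓-clopen     : ∀ A → Clopen τ A → Clopen τ (↓_ _≤_ A)

  module _ (η₁ η₂ : X → Pred (Subset X) 0ℓ) where

    □ : Subset X → Subset X
    □ A = λ x → η₁ x A

    ◇ : Subset X → Subset X
    ◇ A = λ x → ¬ η₂ x (∁ A)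

    record IsModalEsakiaSpace : Set₁ where
      field
        esakia   : IsEsakiaSpace
        -- η₁(x), η₂(x) are sets of subsets (extensional in their argument)
        η₁-resp  : ∀ x {A B} → A ≐ B → η₁ x A → η₁ x B
        η₂-resp  : ∀ x {A B} → A ≐ B → η₂ x A → η₂ x B
        η₁-up    : ∀ x A → η₁ x A → ClopenUp A
        η₂-down  : ∀ x A → η₂ x A → ClopenDown A
        □-up     : ∀ A → ClopenUp A → ClopenUp (□ A)
        ◇-up     : ∀ A → ClopenUp A → ClopenUp (◇ A)
        η₁⇒η₂    : ∀ x A B → ClopenUp A → ClopenUp B → η₁ x A →
                   η₂ x (↓_ _≤_ A ∪ ∁ B)

    record IsMNESpace (C : Subset X) : Set₁ where
      field
        modalEsakia : IsModalEsakiaSpace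
        C-max       : C ⊆ MaxSet _≤_
        C-closed    : Closed τ C
        mne         : ∀ A B → ClopenUp A → ClopenUp B →
                      C ⊆ (A ∪ B) → (A ∩ B) ⊆ ∅ → C ⊆ (□ A ∪ ◇ B)

    F : Subset X → Pred (Subset X) 0ℓ
    F C A = ClopenUp A × C ⊆ A

    record IsBooleanFilter (Fl : Pred (Subset X) 0ℓ) : Set₁ where
      field
        ⊆𝒰       : ∀ A → Fl A → ClopenUp A
        top      : Fl Full
        meet     : ∀ A B → Fl A → Fl B → Fl (A ∩ B)
        upward   : ∀ A B → Fl A → ClopenUp B → A ⊆ B → Fl B
        boolean  : ∀ A → ClopenUp A → (─_ _≤_ (─_ _≤_ A)) ≐ Full → Fl A

    ModalFilterCondition : Pred (Subset X) 0ℓ → Set₁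
    ModalFilterCondition Fl = ∀ A B → ClopenUp A → ClopenUp B →
      (A ∩ B) ⊆ ∅ → Fl (A ∪ B) → Fl (□ A ∪ ◇ B)

    -- ⟨𝒰(X), ∩, ∪, ∅, X, ⇒, □, ◇⟩ is a modal Heyting algebra
    -- (the lattice laws hold automatically for subsets; what must be checked is
    --  closure of 𝒰(X) under the operations, the residuation law, and the modal axiom)
    record IsModalHeytingAlgebra : Set₁ where
      field
        ∅-𝒰      : ClopenUp ∅
        Full-𝒰   : ClopenUp Full
        ∩-𝒰      : ∀ A B → ClopenUp A → ClopenUp B → ClopenUp (A ∩ B)
        ∪-𝒰      : ∀ A B → ClopenUp A → ClopenUp B → ClopenUp (A ∪ B)
        ⇒-𝒰      : ∀ A B → ClopenUp A → ClopenUp B → ClopenUp (_⇒_ _≤_ A B)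
        residual : ∀ W A B → ClopenUp W → ClopenUp A → ClopenUp B →
                   ((W ∩ A) ⊆ B → W ⊆ _⇒_ _≤_ A B) × (W ⊆ _⇒_ _≤_ A B → (W ∩ A) ⊆ B)
        □-𝒰      : ∀ A → ClopenUp A → ClopenUp (□ A)
        ◇-𝒰      : ∀ A → ClopenUp A → ClopenUp (◇ A)
        modal    : ∀ A B → ClopenUp A → ClopenUp B →
                   (□ A ∩ ◇ (─_ _≤_ A ∩ B)) ⊆ ∅

{-# OPTIONS --safe #-}
module Submission where

-- The Esakia
-- condition on ↓ makes A ⇒ B = ∁ ↓(A ∩ ∁ B) clopen; the modal axiom is the
-- condition η₁ ⇒ η₂ read through ↓A ∪ ∁B = ∁(─A ∩ B); F_C is Boolean because
-- ──A and A agree at maximal points; and the filter condition on F_C is the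
-- MNE axiom itself.

open import Defs
open import Level using (0ℓ)
open import Data.Product using (∃; _×_; _,_; proj₁)
open import Data.Sum using (_⊎_; inj₁; inj₂)
open import Data.Unit using (tt)
open import Relation.Binary using (Rel; Reflexive; Transitive; IsPartialOrder)
open import Relation.Binary.PropositionalEquality using (subst)
open import Relation.Unary.Properties using (≐-refl; ≐-sym)
open import Axiom.ExcludedMiddle using (ExcludedMiddle)
open import Axiom.DoubleNegationElimination
  using (DoubleNegationElimination; em⇒dne)

∁-resp-≐ : {X : Set} {A B : Subset X} → A ≐ B → ∁ A ≐ ∁ B
∁-resp-≐ (A⊆B , B⊆A) = (λ ¬a b → ¬a (B⊆A b)) , (λ ¬b a → ¬b (A⊆B a))

∁∪≐∁∩∁ : {X : Set} {A B : Subset X} → ∁ (A ∪ B) ≐ (∁ A ∩ ∁ B)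
∁∪≐∁∩∁ = (λ ¬a∪b → (λ a → ¬a∪b (inj₁ a)) , (λ b → ¬a∪b (inj₂ b)))
       , (λ { (¬a , ¬b) (inj₁ a) → ¬a a ; (¬a , ¬b) (inj₂ b) → ¬b b })

module ClassicalSets (dne : DoubleNegationElimination 0ℓ) {X : Set} where

  ∁∁≐ : {A : Subset X} → ∁ (∁ A) ≐ A
  ∁∁≐ = dne , λ a ¬a → ¬a a

  ∩≐∁[∁∪∁] : {A B : Subset X} → (A ∩ B) ≐ ∁ (∁ A ∪ ∁ B)
  ∩≐∁[∁∪∁] = (λ { (a , b) (inj₁ ¬a) → ¬a a ; (a , b) (inj₂ ¬b) → ¬b b })
           , (λ n → dne (λ ¬a → n (inj₁ ¬a)) , dne (λ ¬b → n (inj₂ ¬b)))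

module Topology {X : Set} {τ : Pred (Subset X) 0ℓ} (T : IsTopology τ) where
  open IsTopology T

  ∪-open : ∀ {A B} → τ A → τ B → τ (A ∪ B)
  ∪-open {A} {B} oA oB = ⋃-open pair (A ∪ B) pair-open cover covered
    where
    pair : Pred (Subset X) 0ℓ
    pair S = S ≐ A ⊎ S ≐ B

    pair-open : ∀ S → pair S → τ S
    pair-open _ (inj₁ S≐A) = open-resp (≐-sym S≐A) oA
    pair-open _ (inj₂ S≐B) = open-resp (≐-sym S≐B) oB

    cover : ∀ x → (A ∪ B) x → ∃ λ S → pair S × S x
    cover _ (inj₁ a) = A , inj₁ ≐-refl , a
    cover _ (inj₂ b) = B , inj₂ ≐-refl , b

    covered : ∀ x → (∃ λ S → pair S × S x) → (A ∪ B) x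
    covered _ (_ , inj₁ (S⊆A , _) , s) = inj₁ (S⊆A s)
    covered _ (_ , inj₂ (S⊆B , _) , s) = inj₂ (S⊆B s)

  clopen-resp-≐ : ∀ {A B} → A ≐ B → Clopen τ A → Clopen τ B
  clopen-resp-≐ A≐B (oA , o∁A) = open-resp A≐B oA , open-resp (∁-resp-≐ A≐B) o∁A

  ∅-clopen : Clopen τ ∅
  ∅-clopen = ∅-open , open-resp ((λ _ ()) , (λ _ → tt)) Full-open

  Full-clopen : Clopen τ Full
  Full-clopen = Full-open , open-resp ((λ ()) , (λ ¬⊤ → ¬⊤ tt)) ∅-open

  ∪-clopen : ∀ {A B} → Clopen τ A → Clopen τ B → Clopen τ (A ∪ B)
  ∪-clopen (oA , o∁A) (oB , o∁B) = ∪-open oA oB , open-resp (≐-sym ∁∪≐∁∩∁) (∩-open o∁A o∁B)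

module ClassicalTopology (dne : DoubleNegationElimination 0ℓ)
  {X : Set} {τ : Pred (Subset X) 0ℓ} (T : IsTopology τ) where
  open IsTopology T
  open Topology T
  open ClassicalSets dne

  ∁-clopen : ∀ {A} → Clopen τ A → Clopen τ (∁ A)
  ∁-clopen (oA , o∁A) = o∁A , open-resp (≐-sym ∁∁≐) oA

  ∩-clopen : ∀ {A B} → Clopen τ A → Clopen τ B → Clopen τ (A ∩ B)
  ∩-clopen cA cB =
    clopen-resp-≐ (≐-sym ∩≐∁[∁∪∁]) (∁-clopen (∪-clopen (∁-clopen cA) (∁-clopen cB)))

module UpSets {X : Set} (_≤_ : Rel X 0ℓ) where

  ∅-up : IsUp _≤_ ∅
  ∅-up _ ()

  Full-up : IsUp _≤_ Full
  Full-up _ _ = tt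

  ∩-up : ∀ {A B} → IsUp _≤_ A → IsUp _≤_ B → IsUp _≤_ (A ∩ B)
  ∩-up uA uB x≤y (a , b) = uA x≤y a , uB x≤y b

  ∪-up : ∀ {A B} → IsUp _≤_ A → IsUp _≤_ B → IsUp _≤_ (A ∪ B)
  ∪-up uA uB x≤y (inj₁ a) = inj₁ (uA x≤y a)
  ∪-up uA uB x≤y (inj₂ b) = inj₂ (uB x≤y b)

  ⇒-up : Transitive _≤_ → ∀ {A B} → IsUp _≤_ (_⇒_ _≤_ A B)
  ⇒-up trans x≤y A⊆B z y≤z a = A⊆B z (trans x≤y y≤z) a

  ⇒-curry : ∀ {W A B} → IsUp _≤_ W → (W ∩ A) ⊆ B → W ⊆ _⇒_ _≤_ A B
  ⇒-curry uW W∩A⊆B w y x≤y a = W∩A⊆B (uW x≤y w , a)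

  ⇒-uncurry : Reflexive _≤_ → ∀ {W A B : Subset X} → W ⊆ _⇒_ _≤_ A B → (W ∩ A) ⊆ B
  ⇒-uncurry refl W⊆A⇒B {x} (w , a) = W⊆A⇒B w x refl a

module ClassicalUpSets (dne : DoubleNegationElimination 0ℓ) {X : Set} (_≤_ : Rel X 0ℓ) where

  ⇒≐∁↓[∩∁] : ∀ {A B} → _⇒_ _≤_ A B ≐ ∁ (↓_ _≤_ (A ∩ ∁ B))
  ⇒≐∁↓[∩∁] = (λ A⊆B (y , (a , ¬b) , x≤y) → ¬b (A⊆B y x≤y a))
           , (λ ¬↓ y x≤y a → dne (λ ¬b → ¬↓ (y , (a , ¬b) , x≤y)))

  ↓∪∁≐∁[─∩] : ∀ {A B} → (↓_ _≤_ A ∪ ∁ B) ≐ ∁ (─_ _≤_ A ∩ B)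
  ↓∪∁≐∁[─∩] {A} {B} = ⊆∁ , ∁⊆
    where
    ⊆∁ : (↓_ _≤_ A ∪ ∁ B) ⊆ ∁ (─_ _≤_ A ∩ B)
    ⊆∁ (inj₁ (a , Aa , x≤a)) (─A , _) = ─A a x≤a Aa
    ⊆∁ (inj₂ ¬b) (_ , b) = ¬b b

    ∁⊆ : ∁ (─_ _≤_ A ∩ B) ⊆ (↓_ _≤_ A ∪ ∁ B)
    ∁⊆ ¬[─A∩B] = dne λ ¬↓∪∁ →
      ¬[─A∩B] ((λ y x≤y a → ¬↓∪∁ (inj₁ (y , a , x≤y))) , dne (λ ¬b → ¬↓∪∁ (inj₂ ¬b)))

  ──-stable-at-max : Reflexive _≤_ → ∀ {A x} → IsMax _≤_ x → (─_ _≤_ (─_ _≤_ A)) x → A x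
  ──-stable-at-max refl {A} max ──A = dne λ ¬a →
    ──A _ refl (λ y x≤y a → ¬a (subst A (max y x≤y) a))

module ClopenUpSets (dne : DoubleNegationElimination 0ℓ)
  {X : Set} {τ : Pred (Subset X) 0ℓ} {_≤_ : Rel X 0ℓ} (E : IsEsakiaSpace τ _≤_) where
  open IsEsakiaSpace E
  open IsPartialOrder partialOrder using (refl; trans)
  open Topology topology
  open ClassicalTopology dne topology
  open UpSets _≤_
  open ClassicalUpSets dne _≤_

  ∅-𝒰 : ClopenUp τ _≤_ ∅
  ∅-𝒰 = ∅-clopen , ∅-up

  Full-𝒰 : ClopenUp τ _≤_ Full
  Full-𝒰 = Full-clopen , Full-up

  ∩-𝒰 : ∀ A B → ClopenUp τ _≤_ A → ClopenUp τ _≤_ B → ClopenUp τ _≤_ (A ∩ B)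
  ∩-𝒰 _ _ (cA , uA) (cB , uB) = ∩-clopen cA cB , ∩-up uA uB

  ∪-𝒰 : ∀ A B → ClopenUp τ _≤_ A → ClopenUp τ _≤_ B → ClopenUp τ _≤_ (A ∪ B)
  ∪-𝒰 _ _ (cA , uA) (cB , uB) = ∪-clopen cA cB , ∪-up uA uB

  ⇒-𝒰 : ∀ A B → ClopenUp τ _≤_ A → ClopenUp τ _≤_ B → ClopenUp τ _≤_ (_⇒_ _≤_ A B)
  ⇒-𝒰 A B (cA , _) (cB , _) =
    clopen-resp-≐ (≐-sym ⇒≐∁↓[∩∁]) (∁-clopen (↓-clopen _ (∩-clopen cA (∁-clopen cB))))
    , ⇒-up trans

  F-isBooleanFilter : ∀ {η₁ η₂ C} → C ⊆ MaxSet _≤_ →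
                      IsBooleanFilter τ _≤_ η₁ η₂ (F τ _≤_ η₁ η₂ C)
  F-isBooleanFilter C⊆max = record
    { ⊆𝒰     = λ _ → proj₁
    ; top     = Full-𝒰 , λ _ → tt
    ; meet    = λ A B (𝒰A , C⊆A) (𝒰B , C⊆B) → ∩-𝒰 A B 𝒰A 𝒰B , λ c → C⊆A c , C⊆B c
    ; upward  = λ _ _ (_ , C⊆A) 𝒰B A⊆B → 𝒰B , λ c → A⊆B (C⊆A c)
    ; boolean = λ _ 𝒰A (_ , Full⊆──A) →
                  𝒰A , λ c → ──-stable-at-max refl (C⊆max c) (Full⊆──A tt)
    }

module ModalClopenUpSets (dne : DoubleNegationElimination 0ℓ)
  {X : Set} {τ : Pred (Subset X) 0ℓ} {_≤_ : Rel X 0ℓ} {η₁ η₂ : X → Pred (Subset X) 0ℓ}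
  (M : IsModalEsakiaSpace τ _≤_ η₁ η₂) where
  open IsModalEsakiaSpace M
  open IsPartialOrder (IsEsakiaSpace.partialOrder esakia) using (refl)
  open ClopenUpSets dne esakia
  open UpSets _≤_
  open ClassicalUpSets dne _≤_

  modal-axiom : ∀ A B → ClopenUp τ _≤_ A → ClopenUp τ _≤_ B →
                (□ τ _≤_ η₁ η₂ A ∩ ◇ τ _≤_ η₁ η₂ (─_ _≤_ A ∩ B)) ⊆ ∅
  modal-axiom A B 𝒰A 𝒰B {x} (□A , ◇[─A∩B]) =
    ◇[─A∩B] (η₂-resp x ↓∪∁≐∁[─∩] (η₁⇒η₂ x A B 𝒰A 𝒰B □A))

  isModalHeytingAlgebra : IsModalHeytingAlgebra τ _≤_ η₁ η₂
  isModalHeytingAlgebra = record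
    { ∅-𝒰      = ∅-𝒰
    ; Full-𝒰   = Full-𝒰
    ; ∩-𝒰      = ∩-𝒰
    ; ∪-𝒰      = ∪-𝒰
    ; ⇒-𝒰      = ⇒-𝒰
    ; residual = λ _ _ _ (_ , uW) _ _ → ⇒-curry uW , ⇒-uncurry refl
    ; □-𝒰      = □-up
    ; ◇-𝒰      = ◇-up
    ; modal    = modal-axiom
    }

F-modalFilterCondition : (dne : DoubleNegationElimination 0ℓ)
  {X : Set} {τ : Pred (Subset X) 0ℓ} {_≤_ : Rel X 0ℓ} {η₁ η₂ : X → Pred (Subset X) 0ℓ}
  {C : Subset X} → IsMNESpace τ _≤_ η₁ η₂ C →
  ModalFilterCondition τ _≤_ η₁ η₂ (F τ _≤_ η₁ η₂ C)
F-modalFilterCondition dne M A B 𝒰A 𝒰B A∩B⊆∅ (_ , C⊆A∪B) =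
  ∪-𝒰 _ _ (□-up A 𝒰A) (◇-up B 𝒰B) , mne A B 𝒰A 𝒰B C⊆A∪B A∩B⊆∅
  where
  open IsMNESpace M
  open IsModalEsakiaSpace modalEsakia
  open ClopenUpSets dne esakia

proposition21 : ExcludedMiddle 0ℓ →
    {X : Set} (τ : Pred (Subset X) 0ℓ) (_≤_ : Rel X 0ℓ)
    (η₁ η₂ : X → Pred (Subset X) 0ℓ) (C : Subset X) →
    IsMNESpace τ _≤_ η₁ η₂ C →
    IsBooleanFilter τ _≤_ η₁ η₂ (F τ _≤_ η₁ η₂ C) ×
    ModalFilterCondition τ _≤_ η₁ η₂ (F τ _≤_ η₁ η₂ C) ×
    IsModalHeytingAlgebra τ _≤_ η₁ η₂
proposition21 lem τ _≤_ η₁ η₂ C M =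
    ClopenUpSets.F-isBooleanFilter dne esakia C-max
  , F-modalFilterCondition dne M
  , ModalClopenUpSets.isModalHeytingAlgebra dne modalEsakia
  where
  dne : DoubleNegationElimination 0ℓ
  dne = em⇒dne lem
  open IsMNESpace M
  open IsModalEsakiaSpace modalEsakia using (esakia)
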